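{- Let $g$ be a global state, $p,q\in\mathcal{PV}$ and $\Gamma\subseteq\mathcal{A}$. If $\phi\in\{\langle\langle\Gamma\rangle\rangle\mathrm{X}\,p,\ \langle\langle\Gamma\rangle\rangle\mathrm{G}\,p,\ \langle\langle\Gamma\rangle\rangle\,p\,\mathrm{U}\,q\}$, then the predicate $Model_{g,\phi}(\mathcal{V}_M)$ is positive monotonic with respect to $TB_i$ for $i\in\Gamma$.
   Context: Fix a set of agents $\mathcal{A}=\{1,\dots,n\}$, a finite set $\mathcal{PV}$ of propositional variables, and for each agent $i$ a finite set of local states $L_i=\{l_i^1,\dots,l_i^{n_i}\}$. Agent $i$ has actions $Act_i=\{a_i^1,\dots,a_i^{n_i}\}$ and a local protocol $P_i:L_i\to 2^{Act_i}$ with $P_i(l)\neq\emptyset$ for all $l$; its local transition function is $T_i(l_i^k,a_i^j)=l_i^j$, defined iff $a_i^j\in P_i(l_i^k)$. A model is $M=(St,T,V)$ with $St=L_1\times\dots\times L_n$, global actions $Act=Act_1\times\dots\times Act_n$, global transition $T(g,a)=g'$ iff $T_i(g^i,a^i)=g'^i$ for all $i$ (superscript $i$ denotes the $i$-th component), and valuation $V:St\to 2^{\mathcal{PV}}$. Encoding: $P_i$ is a Boolean $n_i\times n_i$ table (entry $(l,a)$ is $1$ iff $a\in P_i(l)$) flattened into $tb_i$; $V$ is a bit vector $vb$ of length $|St|\cdot|\mathcal{PV}|$ (entry $(g,p)$ is $1$ iff $p\in V(g)$). The model is encoded by $v_M=(tb_1,\dots,tb_n,vb)$; $\mathcal{V}_M=(TB_1,\dots,TB_n,VB)$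 is the corresponding vector of Boolean variables; only vectors encoding models (each local state has at least one available action) are considered. A path from $g$ is $g_0a_0g_1a_1\dots$ with $g_0=g$, $T(g_k,a_k)=g_{k+1}$; $\pi[k]=g_k$. A strategy of agent $i$ is $\sigma_i:St\to Act_i$ with $\sigma_i(g)\in P_i(g^i)$; a joint strategy $\sigma_\Gamma$ is a tuple of strategies of agents in $\Gamma$; $out_M(g,\sigma_\Gamma)$ is the set of paths from $g$ with $a_k^j=\sigma_j(g_k)$ for all $k$ and $j\in\Gamma$. $M,g\models\langle\langle\Gamma\rangle\rangle\mathrm{X}\varphi$ iff there is $\sigma_\Gamma$ with $out_M(g,\sigma_\Gamma)\neq\emptyset$ and $M,\pi[1]\models\varphi$ for every $\pi$ in it; $M,g\models\langle\langle\Gamma\rangle\rangle\varphi_1\mathrm{U}\varphi_2$ iff there is $\sigma_\Gamma$ with nonempty outcome such that every $\pi$ in it has $i\ge0$ with $M,\pi[i]\models\varphi_2$ and $M,\pi[j]\models\varphi_1$ for $j<i$; $M,g\models\langle\langle\Gamma\rangle\rangle\mathrm{G}\varphi$ iff there is $\sigma_\Gamma$ with nonempty outcome such that $M,\pi[i]\models\varphi$ for all $i\ge 0$ and all $\pi$ in it; $M,g\models p$ iff $p\in V(g)$. $Model_{g,\phi}(v_M)=1$ iff $M,g\models\phi$ for the model $M$ encoded by $v_M$. A predicate on bit vectors is positive monotonic w.r.t. a set $W$ of its variables if changing any single variable of $W$ from $0$ to $1$ (others fixed) preserves the value $1$. -}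

module Defs where

open import Data.Nat using (ℕ; zero; suc; _<_)
open import Data.Fin using (Fin; _≟_)
open import Data.Fin.Subset using (Subset; _∈_)
open import Data.Bool using (Bool; true; false; if_then_else_; _∧_)
open import Data.Product using (Σ; _×_; _,_; proj₁)
open import Relation.Nullary.Decidable using (⌊_⌋; yes; no)
open import Relation.Binary.PropositionalEquality using (_≡_; refl)

-- n agents (Fin n); agent i has ns i local states l_i^1..l_i^{n_i}
-- (represented by Fin (ns i)) and ns i actions (also Fin (ns i)):
-- action a_i^j leads to local state l_i^j.

St : {n : ℕ} → (Fin n → ℕ) → Set
St {n} ns = (i : Fin n) → Fin (ns i)

Act : {n : ℕ} → (Fin n → ℕ) → Set
Act {n} ns = (i : Fin n) → Fin (ns i)

-- Protocol tables TB_i (entry (l,a) is true iff a ∈ P_i(l))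
Tables : {n : ℕ} → (Fin n → ℕ) → Set
Tables {n} ns = (i : Fin n) → Fin (ns i) → Fin (ns i) → Bool

-- Encoding v_M = (tb_1, …, tb_n, vb); each bit is an entry of tb i or vb.
record Enc {n : ℕ} (ns : Fin n → ℕ) (m : ℕ) : Set where
  field
    tb : Tables ns
    vb : St ns → Fin m → Bool
open Enc public

-- only vectors encoding models are considered: every local state has an action
ValidEnc : {n : ℕ} {ns : Fin n → ℕ} {m : ℕ} → Enc ns m → Set
ValidEnc {n} {ns} e = (i : Fin n) (l : Fin (ns i)) → Σ (Fin (ns i)) (λ a → tb e i l a ≡ true)

-- global transition: T(g,a) = g' iff T_i(g^i,a^i) = g'^i for all i,
-- where T_i(l_i^k, a_i^j) = l_i^j is defined iff a_i^j ∈ P_i(l_i^k)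
Trans : {n : ℕ} {ns : Fin n → ℕ} {m : ℕ} → Enc ns m → St ns → Act ns → St ns → Set
Trans {n} e g a g' = (i : Fin n) → (tb e i (g i) (a i) ≡ true) × (g' i ≡ a i)

record Path {n : ℕ} {ns : Fin n → ℕ} {m : ℕ} (e : Enc ns m) : Set where
  field
    states : ℕ → St ns
    acts   : ℕ → Act ns
    step   : (k : ℕ) → Trans e (states k) (acts k) (states (suc k))
open Path public

Strategy : {n : ℕ} {ns : Fin n → ℕ} {m : ℕ} → Enc ns m → Subset n → Set
Strategy {n} {ns} e Γ =
  (i : Fin n) → i ∈ Γ → (g : St ns) → Σ (Fin (ns i)) (λ a → tb e i (g i) a ≡ true)

Out : {n : ℕ} {ns : Fin n → ℕ} {m : ℕ} (e : Enc ns m) → St ns → (Γ : Subset n) →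
      Strategy e Γ → Path e → Set
Out {n} e g Γ σ π =
  (states π 0 ≡ g) ×
  ((k : ℕ) (i : Fin n) (h : i ∈ Γ) → acts π k i ≡ proj₁ (σ i h (states π k)))

data Formula (n m : ℕ) : Set where
  atom  : Fin m → Formula n m
  ⟪_⟫X_ : Subset n → Formula n m → Formula n m
  ⟪_⟫G_ : Subset n → Formula n m → Formula n m
  ⟪_⟫_U_ : Subset n → Formula n m → Formula n m → Formula n m

Sat : {n : ℕ} {ns : Fin n → ℕ} {m : ℕ} → Enc ns m → St ns → Formula n m → Set
Sat e g (atom p) = vb e g p ≡ true
Sat e g (⟪ Γ ⟫X φ) =
  Σ (Strategy e Γ) λ σ → Σ (Path e) (λ π → Out e g Γ σ π) ×
    ((π : Path e) → Out e g Γ σ π → Sat e (states π 1) φ)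
Sat e g (⟪ Γ ⟫G φ) =
  Σ (Strategy e Γ) λ σ → Σ (Path e) (λ π → Out e g Γ σ π) ×
    ((π : Path e) → Out e g Γ σ π → (k : ℕ) → Sat e (states π k) φ)
Sat e g (⟪ Γ ⟫ φ₁ U φ₂) =
  Σ (Strategy e Γ) λ σ → Σ (Path e) (λ π → Out e g Γ σ π) ×
    ((π : Path e) → Out e g Γ σ π →
      Σ ℕ λ k → Sat e (states π k) φ₂ × ((j : ℕ) → j < k → Sat e (states π j) φ₁))

Model : {n : ℕ} {ns : Fin n → ℕ} {m : ℕ} → St ns → Formula n m → Enc ns m → Set
Model g φ e = Sat e g φ

setTB : {n : ℕ} {ns : Fin n → ℕ} → Tables ns → (i : Fin n) → Fin (ns i) → Fin (ns i) → Tables ns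
setTB tb i l a j with j ≟ i
... | yes refl = λ l' a' → if ⌊ l' ≟ l ⌋ ∧ ⌊ a' ≟ a ⌋ then true else tb i l' a'
... | no _ = tb j

setEnc : {n : ℕ} {ns : Fin n → ℕ} {m : ℕ} → Enc ns m → (i : Fin n) → Fin (ns i) → Fin (ns i) → Enc ns m
setEnc e i l a = record { tb = setTB (tb e) i l a ; vb = vb e }

PosMonoTB : {n : ℕ} {ns : Fin n → ℕ} {m : ℕ} → (Enc ns m → Set) → Subset n → Set
PosMonoTB {n} {ns} {m} Pred Γ =
  (e : Enc ns m) → ValidEnc e →
  (i : Fin n) → i ∈ Γ → (l a : Fin (ns i)) →
  tb e i l a ≡ false → Pred e → Pred (setEnc e i l a)

-- Adding an action to the protocol of an agent in Γ can only help Γ. A Γ-strategy of the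
-- old model is still a strategy of the new one, and its outcome set does not change: the
-- actions of the agents in Γ are prescribed by the strategy and were already allowed, while
-- the protocols of the agents outside Γ are untouched. So every path property that Γ could
-- enforce from g before, it still enforces; X p, G p and p U q are such properties.
module Submission where

open import Defs
open import Data.Nat using (ℕ; _<_)
open import Data.Empty using (⊥-elim)
open import Data.Fin using (Fin; _≟_)
open import Data.Fin.Subset using (Subset; _∈_; _∉_)
open import Data.Fin.Subset.Properties using (_∈?_)
open import Data.Sum using (_⊎_; inj₁; inj₂)
open import Data.Bool using (true; false; _∧_)
open import Data.Product using (Σ; _×_; _,_; proj₁; proj₂)
open import Relation.Nullary using (yes; no)
open import Relation.Nullary.Decidable using (⌊_⌋)
open import Relation.Binary.PropositionalEquality using (_≡_; _≢_; refl; sym; subst)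

Enforces : {n : ℕ} {ns : Fin n → ℕ} {m : ℕ} →
           Enc ns m → St ns → Subset n → ((ℕ → St ns) → Set) → Set
Enforces e g Γ P =
  Σ (Strategy e Γ) λ σ → Σ (Path e) (λ π → Out e g Γ σ π) ×
    ((π : Path e) → Out e g Γ σ π → P (states π))

record GrowsWithin {n : ℕ} {ns : Fin n → ℕ} (Γ : Subset n) (t t′ : Tables ns) : Set where
  field
    extends      : ∀ j l a → t j l a ≡ true → t′ j l a ≡ true
    fixedOutside : ∀ j → j ∉ Γ → ∀ l a → t′ j l a ≡ true → t j l a ≡ true

module _ {n : ℕ} {ns : Fin n → ℕ} {m : ℕ} {Γ : Subset n} {e e′ : Enc ns m}
         (grows : GrowsWithin Γ (tb e) (tb e′)) where

  open GrowsWithin grows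

  liftStrategy : Strategy e Γ → Strategy e′ Γ
  liftStrategy σ j j∈Γ g = proj₁ (σ j j∈Γ g) , extends j (g j) _ (proj₂ (σ j j∈Γ g))

  liftPath : Path e → Path e′
  liftPath π = record
    { states = states π
    ; acts   = acts π
    ; step   = λ k j → extends j _ _ (proj₁ (step π k j)) , proj₂ (step π k j)
    }

  module _ {g : St ns} (σ : Strategy e Γ) (π : Path e′) (out : Out e′ g Γ (liftStrategy σ) π) where

    allowedBefore : ∀ k j → tb e j (states π k j) (acts π k j) ≡ true
    allowedBefore k j with j ∈? Γ
    ... | yes j∈Γ = subst (λ a → tb e j (states π k j) a ≡ true)
                          (sym (proj₂ out k j j∈Γ)) (proj₂ (σ j j∈Γ (states π k)))
    ... | no j∉Γ  = fixedOutside j j∉Γ _ _ (proj₁ (step π k j))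

    restrictOutcome : Path e
    restrictOutcome = record
      { states = states π
      ; acts   = acts π
      ; step   = λ k j → allowedBefore k j , proj₂ (step π k j)
      }

  enforces-grow : {g : St ns} (P : (ℕ → St ns) → Set) → Enforces e g Γ P → Enforces e′ g Γ P
  enforces-grow P (σ , (π , out) , holds) =
    liftStrategy σ , (liftPath π , out) ,
    λ π′ out′ → holds (restrictOutcome σ π′ out′) out′

setTB-extends : {n : ℕ} {ns : Fin n → ℕ} (t : Tables ns) (i : Fin n) (l a : Fin (ns i)) →
                ∀ j l′ a′ → t j l′ a′ ≡ true → setTB t i l a j l′ a′ ≡ true
setTB-extends t i l a j l′ a′ allowed with j ≟ i
... | no _ = allowed
... | yes refl with ⌊ l′ ≟ l ⌋ ∧ ⌊ a′ ≟ a ⌋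
...   | true  = refl
...   | false = allowed

setTB-≢ : {n : ℕ} {ns : Fin n → ℕ} (t : Tables ns) (i : Fin n) (l a : Fin (ns i)) →
          ∀ j → j ≢ i → setTB t i l a j ≡ t j
setTB-≢ t i l a j j≢i with j ≟ i
... | yes j≡i = ⊥-elim (j≢i j≡i)
... | no _    = refl

setTB-growsWithin : {n : ℕ} {ns : Fin n → ℕ} {Γ : Subset n} (t : Tables ns)
                    (i : Fin n) → i ∈ Γ → (l a : Fin (ns i)) → GrowsWithin Γ t (setTB t i l a)
setTB-growsWithin t i i∈Γ l a = record
  { extends      = setTB-extends t i l a
  ; fixedOutside = λ j j∉Γ l′ a′ →
      subst (λ row → row l′ a′ ≡ true) (setTB-≢ t i l a j (λ { refl → j∉Γ i∈Γ }))
  }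

theorem3p6 : (n : ℕ) (ns : Fin n → ℕ) (m : ℕ) (g : St ns) (p q : Fin m) (Γ : Subset n)
             (φ : Formula n m) →
             (φ ≡ ⟪ Γ ⟫X atom p) ⊎ (φ ≡ ⟪ Γ ⟫G atom p) ⊎ (φ ≡ ⟪ Γ ⟫ atom p U atom q) →
             PosMonoTB (Model g φ) Γ
theorem3p6 n ns m g p q Γ φ shape e _ i i∈Γ l a _ = case shape
  where
  grows : GrowsWithin Γ (tb e) (tb (setEnc e i l a))
  grows = setTB-growsWithin (tb e) i i∈Γ l a

  holds : St ns → Fin m → Set
  holds g′ r = vb e g′ r ≡ true

  case : (φ ≡ ⟪ Γ ⟫X atom p) ⊎ (φ ≡ ⟪ Γ ⟫G atom p) ⊎ (φ ≡ ⟪ Γ ⟫ atom p U atom q) →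
         Model g φ e → Model g φ (setEnc e i l a)
  case (inj₁ refl)        = enforces-grow grows (λ s → holds (s 1) p)
  case (inj₂ (inj₁ refl)) = enforces-grow grows (λ s → ∀ k → holds (s k) p)
  case (inj₂ (inj₂ refl)) = enforces-grow grows
    (λ s → Σ ℕ λ k → holds (s k) q × (∀ j → j < k → holds (s j) p))
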